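{- Let $\mathbb R=(R_1,\dots,R_n)$ be a profile of total quasi-orders (reflexive, transitive and complete relations) on a finite set $X$. Define, with the convention $0/0:=1$, $\pi(x,y)=\frac{p_{xy}}{p_{xy}+p_{yx}}$ and $\varrho(x,y)=\frac{r_{xy}}{r_{xy}+r_{yx}}$, and $d_P(x,y)=1-\pi(x,y)$, $d_R(x,y)=1-\varrho(x,y)$. Then for all $x,y,z\in X$, $d_P(x,y)+d_P(y,z)\ge d_P(x,z)$ and $d_R(x,y)+d_R(y,z)\ge d_R(x,z)$.
   Context: $P_i=R_i\setminus R_i^{op}$ is the strict part of $R_i$; $r_{xy}=|\{i\in\{1,\dots,n\}:xR_iy\}|$ and $p_{xy}=|\{i:xP_iy\}|$. -}

module Defs where

open import Level using (0ℓ)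
open import Data.Nat using (ℕ; zero; suc; _+_)
open import Data.Fin using (Fin)
open import Data.Integer using (+_)
open import Data.Rational using (ℚ; _/_; 1ℚ; _-_)
open import Relation.Nullary using (¬_; Dec; yes; no)
open import Relation.Nullary.Decidable using (_×-dec_; ¬?)
open import Data.Product using (_×_)
open import Relation.Binary using (Rel; Decidable; IsTotalPreorder)
open import Relation.Binary.PropositionalEquality using (_≡_)

count : ∀ {n} {P : Fin n → Set} → (∀ i → Dec (P i)) → ℕ
count {zero} d = 0
count {suc n} d with d Fin.zero
... | yes _ = suc (count (λ i → d (Fin.suc i)))
... | no _ = count (λ i → d (Fin.suc i))

-- A profile of n total quasi-orders on X = Fin m (decidable, as X is finite)
record Profile (n m : ℕ) : Set₁ where
  field
    R     : Fin n → Rel (Fin m) 0ℓ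
    R?    : ∀ i → Decidable (R i)
    total : ∀ i → IsTotalPreorder _≡_ (R i)

module _ {n m : ℕ} (ℝ : Profile n m) where
  open Profile ℝ

  P : Fin n → Rel (Fin m) 0ℓ
  P i x y = R i x y × ¬ R i y x

  P? : ∀ i → Decidable (P i)
  P? i x y = R? i x y ×-dec ¬? (R? i y x)

  r : Fin m → Fin m → ℕ
  r x y = count (λ i → R? i x y)

  p : Fin m → Fin m → ℕ
  p x y = count (λ i → P? i x y)

ratio : ℕ → ℕ → ℚ
ratio a b with a + b
... | zero  = 1ℚ
... | suc k = (+ a) / suc k

module _ {n m : ℕ} (ℝ : Profile n m) where
  π : Fin m → Fin m → ℚ
  π x y = ratio (p ℝ x y) (p ℝ y x)

  ϱ : Fin m → Fin m → ℚ
  ϱ x y = ratio (r ℝ x y) (r ℝ y x)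

  d-P : Fin m → Fin m → ℚ
  d-P x y = 1ℚ - π x y

  d-R : Fin m → Fin m → ℚ
  d-R x y = 1ℚ - ϱ x y

module Submission where

-- For a count c (c = r or c = p) the distances are d x y = c y x / (c x y + c y x), with
-- 0/0 = 0 (the convention 0/0 := 1 for ϱ and π turns into 0 for 1 - ϱ and 1 - π).
-- Each R_i and each P_i is cotransitive (x R z gives x R y or y R z), so c itself satisfies
-- the triangle inequality c x z ≤ c x y + c y z, and nothing else is used. Since t ↦ t/(t+B)
-- is increasing, d x z ≤ s/(s + c x z) with s = c y x + c z y ≥ c z x; splitting this as
-- c y x / T + c z y / T with T = s + c x z and noting that T dominates both denominators
-- c x y + c y x and c y z + c z y gives d x z ≤ d x y + d y z.

module Cotransitivity where
  open import Data.Product using (_×_; _,_)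
  open import Data.Sum using (inj₁; inj₂)
  open import Relation.Nullary using (¬_; yes; no; contradiction)
  open import Relation.Binary using (Rel; Decidable; IsTotalPreorder)
  open import Relation.Binary.Definitions using (Cotransitive)

  module _ {a ℓ₁ ℓ₂} {A : Set a} {_≈_ : Rel A ℓ₁} {_≲_ : Rel A ℓ₂}
           (isTotalPreorder : IsTotalPreorder _≈_ _≲_) where
    open IsTotalPreorder isTotalPreorder using (total; trans)

    totalPreorder-cotrans : Cotransitive _≲_
    totalPreorder-cotrans {x} x≲y z with total x z
    ... | inj₁ x≲z = inj₁ x≲z
    ... | inj₂ z≲x = inj₂ (trans z≲x x≲y)

    strictPart-cotrans : Decidable _≲_ → Cotransitive (λ x y → x ≲ y × ¬ y ≲ x)
    strictPart-cotrans _≲?_ {x} (x≲y , y≴x) z with z ≲? x | total x z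
    ... | yes z≲x | _        = inj₂ (trans z≲x x≲y , λ y≲z → y≴x (trans y≲z z≲x))
    ... | no z≴x  | inj₁ x≲z = inj₁ (x≲z , z≴x)
    ... | no z≴x  | inj₂ z≲x = contradiction z≲x z≴x

module Counting where
  open import Data.Nat as ℕ using (ℕ; _+_; _≤_; z≤n; s≤s)
  open import Data.Nat.Properties using (+-mono-≤; module ≤-Reasoning)
  open import Data.Fin using (Fin; zero; suc)
  open import Data.Sum using (_⊎_; [_,_]′)
  open import Function using (_∘_)
  open import Relation.Nullary using (Dec; yes; no; contradiction)
  open import Relation.Binary using (Rel; Decidable)
  open import Relation.Binary.Definitions using (Cotransitive)
  open import Relation.Binary.PropositionalEquality using (_≡_; refl; sym; cong₂)
  open import Algebra.Properties.CommutativeSemigroup Data.Nat.Properties.+-commutativeSemigroup using (interchange)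
  open import Level using (0ℓ)
  open import Defs using (count)

  indicator : ∀ {p} {P : Set p} → Dec P → ℕ
  indicator (yes _) = 1
  indicator (no _)  = 0

  count-suc : ∀ {n} {P : Fin (ℕ.suc n) → Set} (P? : ∀ i → Dec (P i)) →
              count P? ≡ indicator (P? zero) + count (P? ∘ suc)
  count-suc P? with P? zero
  ... | yes _ = refl
  ... | no _  = refl

  indicator-≤-+ : ∀ {P Q S : Set} (P? : Dec P) (Q? : Dec Q) (S? : Dec S) →
                  (P → Q ⊎ S) → indicator P? ≤ indicator Q? + indicator S?
  indicator-≤-+ (no _)  _       _       _   = z≤n
  indicator-≤-+ (yes _) (yes _) _       _   = s≤s z≤n
  indicator-≤-+ (yes _) (no _)  (yes _) _   = s≤s z≤n
  indicator-≤-+ (yes p) (no ¬q) (no ¬s) P⇒Q⊎S = [ (λ q → contradiction q ¬q) , (λ s → contradiction s ¬s) ]′ (P⇒Q⊎S p)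

  count-≤-+ : ∀ {n} {P Q S : Fin n → Set}
              (P? : ∀ i → Dec (P i)) (Q? : ∀ i → Dec (Q i)) (S? : ∀ i → Dec (S i)) →
              (∀ i → P i → Q i ⊎ S i) → count P? ≤ count Q? + count S?
  count-≤-+ {ℕ.zero}  _  _  _  _       = z≤n
  count-≤-+ {ℕ.suc n} {P} {Q} {S} P? Q? S? P⊆Q∪S = begin
    count P?                  ≡⟨ count-suc P? ⟩
    p₀ + count P?′            ≤⟨ +-mono-≤ (indicator-≤-+ (P? zero) (Q? zero) (S? zero) (P⊆Q∪S zero))
                                          (count-≤-+ P?′ Q?′ S?′ (P⊆Q∪S ∘ suc)) ⟩
    (q₀ + s₀) + (count Q?′ + count S?′) ≡⟨ interchange q₀ s₀ (count Q?′) (count S?′) ⟩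
    (q₀ + count Q?′) + (s₀ + count S?′) ≡⟨ sym (cong₂ _+_ (count-suc Q?) (count-suc S?)) ⟩
    count Q? + count S?       ∎
    where
    open ≤-Reasoning
    P?′ : ∀ i → Dec (P (suc i))
    P?′ = P? ∘ suc
    Q?′ : ∀ i → Dec (Q (suc i))
    Q?′ = Q? ∘ suc
    S?′ : ∀ i → Dec (S (suc i))
    S?′ = S? ∘ suc
    p₀ q₀ s₀ : ℕ
    p₀ = indicator (P? zero)
    q₀ = indicator (Q? zero)
    s₀ = indicator (S? zero)

  count-triangle : ∀ {n a} {A : Set a} {_∼_ : Fin n → Rel A 0ℓ} (∼? : ∀ i → Decidable (_∼_ i)) →
                   (∀ i → Cotransitive (_∼_ i)) →
                   ∀ x y z → count (λ i → ∼? i x z) ≤ count (λ i → ∼? i x y) + count (λ i → ∼? i y z)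
  count-triangle ∼? cotrans x y z = count-≤-+ _ _ _ (λ i x∼z → cotrans i x∼z y)

module Shares where
  open import Data.Nat as ℕ using (ℕ; zero; suc; pred; z≤n; s≤s)
  import Data.Nat.Properties as ℕ
  import Data.Nat.Tactic.RingSolver as ℕ-Solver
  open import Data.Integer as ℤ using (ℤ; +_)
  import Data.Integer.Properties as ℤ
  import Data.Integer.Tactic.RingSolver as ℤ-Solver
  open import Data.Rational as ℚ using (ℚ; 1ℚ; toℚᵘ)
  open import Data.Rational.Properties using (toℚᵘ-homo-+; toℚᵘ-homo‿-; toℚᵘ-fromℚᵘ; toℚᵘ-cancel-≤)
  open import Data.Rational.Unnormalised using (ℚᵘ; mkℚᵘ; 1ℚᵘ; _≤_; _≃_; _+_; _-_; *≤*; *≡*)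
  open import Data.Rational.Unnormalised.Properties
    using (+-mono-≤; +-cong; +-congʳ; -‿cong; ≃-trans; ≃-reflexive; module ≤-Reasoning)
  open import Relation.Binary.PropositionalEquality using (_≡_; refl; sym; trans; cong; cong₂; subst₂; module ≡-Reasoning)
  open import Defs using (ratio)

  -- The denominator d is read as suc (pred d), so a ÷ 0 is the junk value a.
  _÷_ : ℕ → ℕ → ℚᵘ
  a ÷ d = mkℚᵘ (+ a) (pred d)

  share : ℕ → ℕ → ℚᵘ
  share a b = a ÷ (a ℕ.+ b)

  cross-≤⇒÷-≤ : ∀ a b d d′ → a ℕ.* suc (pred d′) ℕ.≤ b ℕ.* suc (pred d) → a ÷ d ≤ b ÷ d′
  cross-≤⇒÷-≤ a b _ _ h = *≤* (subst₂ ℤ._≤_ (ℤ.pos-* a _) (ℤ.pos-* b _) (ℤ.+≤+ h))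

  ÷-antimonoʳ-≤ : ∀ a {d d′} → d ℕ.≤ d′ → a ÷ d′ ≤ a ÷ d
  ÷-antimonoʳ-≤ a {d} {d′} d≤d′ = cross-≤⇒÷-≤ a a d′ d (ℕ.*-monoʳ-≤ a (s≤s (ℕ.pred-mono-≤ d≤d′)))

  ÷-+ : ∀ a b d → a ÷ d + b ÷ d ≃ (a ℕ.+ b) ÷ d
  ÷-+ a b d = *≡* (begin
    (+ a ℤ.* D ℤ.+ + b ℤ.* D) ℤ.* D  ≡⟨ distrib (+ a) (+ b) D ⟩
    (+ a ℤ.+ + b) ℤ.* (D ℤ.* D)      ≡⟨ cong₂ ℤ._*_ (sym (ℤ.pos-+ a b)) (sym (ℤ.pos-* (suc (pred d)) (suc (pred d)))) ⟩
    + (a ℕ.+ b) ℤ.* + (suc (pred d) ℕ.* suc (pred d)) ∎)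
    where
    open ≡-Reasoning
    D : ℤ
    D = + suc (pred d)
    distrib : ∀ x y z → (x ℤ.* z ℤ.+ y ℤ.* z) ℤ.* z ≡ (x ℤ.+ y) ℤ.* (z ℤ.* z)
    distrib = ℤ-Solver.solve-∀

  share-monoˡ-≤ : ∀ {a a′} b → a ℕ.≤ a′ → share a b ≤ share a′ b
  share-monoˡ-≤ {zero} {a′} b _ = cross-≤⇒÷-≤ 0 a′ b (a′ ℕ.+ b) z≤n
  share-monoˡ-≤ {suc a} {suc a′} b (s≤s a≤a′) = cross-≤⇒÷-≤ (suc a) (suc a′) (suc a ℕ.+ b) (suc a′ ℕ.+ b) (begin
    suc a ℕ.* (suc a′ ℕ.+ b)             ≡⟨ ℕ.*-distribˡ-+ (suc a) (suc a′) b ⟩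
    suc a ℕ.* suc a′ ℕ.+ suc a ℕ.* b     ≤⟨ ℕ.+-mono-≤ (ℕ.≤-reflexive (ℕ.*-comm (suc a) (suc a′))) (ℕ.*-monoˡ-≤ b (s≤s a≤a′)) ⟩
    suc a′ ℕ.* suc a ℕ.+ suc a′ ℕ.* b    ≡⟨ ℕ.*-distribˡ-+ (suc a′) (suc a) b ⟨
    suc a′ ℕ.* (suc a ℕ.+ b)             ∎)
    where open ℕ.≤-Reasoning

  1-÷≃÷ : ∀ a b k → a ℕ.+ b ≡ suc k → 1ℚᵘ - a ÷ suc k ≃ b ÷ suc k
  1-÷≃÷ a b k a+b≡1+k = *≡* (cross (+ a) (+ b) (+ suc k) (trans (cong +_ (sym a+b≡1+k)) (ℤ.pos-+ a b)))
    where
    -- ↥ (1ℚᵘ - u / s) ℤ.* s ≡ v ℤ.* ↧ (1ℚᵘ - u / s), as ℚᵘ subtraction unfolds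
    identity : ∀ u v → (+ 1 ℤ.* (u ℤ.+ v) ℤ.+ (ℤ.- u) ℤ.* + 1) ℤ.* (u ℤ.+ v) ≡ v ℤ.* (+ 1 ℤ.* (u ℤ.+ v))
    identity = ℤ-Solver.solve-∀
    cross : ∀ u v s → s ≡ u ℤ.+ v → (+ 1 ℤ.* s ℤ.+ (ℤ.- u) ℤ.* + 1) ℤ.* s ≡ v ℤ.* (+ 1 ℤ.* s)
    cross u v _ refl = identity u v

  1-ratio≃÷ : ∀ a b → toℚᵘ (1ℚ ℚ.- ratio a b) ≃ b ÷ (a ℕ.+ b)
  1-ratio≃÷ a b with a ℕ.+ b in a+b≡
  ... | zero rewrite ℕ.m+n≡0⇒n≡0 a a+b≡ = *≡* refl
  ... | suc k = begin-equality
    toℚᵘ (1ℚ ℚ.- q)             ≃⟨ toℚᵘ-homo-+ 1ℚ (ℚ.- q) ⟩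
    toℚᵘ 1ℚ + toℚᵘ (ℚ.- q)      ≃⟨ +-congʳ (toℚᵘ 1ℚ) (toℚᵘ-homo‿- q) ⟩
    1ℚᵘ - toℚᵘ q                ≃⟨ +-congʳ 1ℚᵘ (-‿cong (toℚᵘ-fromℚᵘ (a ÷ suc k))) ⟩
    1ℚᵘ - a ÷ suc k             ≃⟨ 1-÷≃÷ a b k a+b≡ ⟩
    b ÷ suc k                   ∎
    where
    open ≤-Reasoning
    q : ℚ
    q = + a ℚ./ suc k

  1-ratio≃share : ∀ a b → toℚᵘ (1ℚ ℚ.- ratio a b) ≃ share b a
  1-ratio≃share a b = ≃-trans (1-ratio≃÷ a b) (≃-reflexive (cong (b ÷_) (ℕ.+-comm a b)))

  module _ {a} {A : Set a} (c : A → A → ℕ) where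

    ratioDistance : A → A → ℚ
    ratioDistance x y = 1ℚ ℚ.- ratio (c x y) (c y x)

    module _ (c-triangle : ∀ x y z → c x z ℕ.≤ c x y ℕ.+ c y z) where

      share-triangle : ∀ x y z → share (c z x) (c x z) ≤ share (c y x) (c x y) + share (c z y) (c y z)
      share-triangle x y z = begin
        share (c z x) (c x z)                          ≤⟨ share-monoˡ-≤ (c x z) zx≤yx+zy ⟩
        (c y x ℕ.+ c z y) ÷ T                          ≃⟨ ÷-+ (c y x) (c z y) T ⟨
        c y x ÷ T + c z y ÷ T                          ≤⟨ +-mono-≤ (÷-antimonoʳ-≤ (c y x) yx+xy≤T) (÷-antimonoʳ-≤ (c z y) zy+yz≤T) ⟩
        share (c y x) (c x y) + share (c z y) (c y z)  ∎
        where
        open ≤-Reasoning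
        T : ℕ
        T = (c y x ℕ.+ c z y) ℕ.+ c x z
        zx≤yx+zy : c z x ℕ.≤ c y x ℕ.+ c z y
        zx≤yx+zy = ℕ.≤-trans (c-triangle z y x) (ℕ.≤-reflexive (ℕ.+-comm (c z y) (c y x)))
        yx+xy≤T : c y x ℕ.+ c x y ℕ.≤ T
        yx+xy≤T = ℕ.≤-trans (ℕ.+-monoʳ-≤ (c y x) (c-triangle x z y)) (ℕ.≤-reflexive (swap₂₃ (c y x) (c x z) (c z y)))
          where
          swap₂₃ : ∀ u v w → u ℕ.+ (v ℕ.+ w) ≡ (u ℕ.+ w) ℕ.+ v
          swap₂₃ = ℕ-Solver.solve-∀
        zy+yz≤T : c z y ℕ.+ c y z ℕ.≤ T
        zy+yz≤T = ℕ.≤-trans (ℕ.+-monoʳ-≤ (c z y) (c-triangle y x z)) (ℕ.≤-reflexive (swap₁₂ (c z y) (c y x) (c x z)))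
          where
          swap₁₂ : ∀ u v w → u ℕ.+ (v ℕ.+ w) ≡ (v ℕ.+ u) ℕ.+ w
          swap₁₂ = ℕ-Solver.solve-∀

      ratioDistance-triangle : ∀ x y z → ratioDistance x z ℚ.≤ ratioDistance x y ℚ.+ ratioDistance y z
      ratioDistance-triangle x y z = toℚᵘ-cancel-≤ (begin
        toℚᵘ (ratioDistance x z)                           ≃⟨ 1-ratio≃share (c x z) (c z x) ⟩
        share (c z x) (c x z)                              ≤⟨ share-triangle x y z ⟩
        share (c y x) (c x y) + share (c z y) (c y z)      ≃⟨ +-cong (1-ratio≃share (c x y) (c y x)) (1-ratio≃share (c y z) (c z y)) ⟨
        toℚᵘ (ratioDistance x y) + toℚᵘ (ratioDistance y z) ≃⟨ toℚᵘ-homo-+ (ratioDistance x y) (ratioDistance y z) ⟨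
        toℚᵘ (ratioDistance x y ℚ.+ ratioDistance y z)     ∎)
        where open ≤-Reasoning

open import Defs
open import Data.Nat as ℕ using (ℕ)
open import Data.Fin using (Fin)
open import Data.Product using (_×_; _,_)
open import Data.Rational using (_+_; _≤_)
open Cotransitivity
open Counting
open Shares

mainTheorem7 : (n m : ℕ) (ℝ : Profile n m) (x y z : Fin m) →
    (d-P ℝ x z ≤ d-P ℝ x y + d-P ℝ y z) × (d-R ℝ x z ≤ d-R ℝ x y + d-R ℝ y z)
mainTheorem7 n m ℝ x y z =
  ratioDistance-triangle (p ℝ) p-triangle x y z , ratioDistance-triangle (r ℝ) r-triangle x y z
  where
  open Profile ℝ
  p-triangle : ∀ x y z → p ℝ x z ℕ.≤ p ℝ x y ℕ.+ p ℝ y z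
  p-triangle = count-triangle (P? ℝ) (λ i → strictPart-cotrans (total i) (R? i))
  r-triangle : ∀ x y z → r ℝ x z ℕ.≤ r ℝ x y ℕ.+ r ℝ y z
  r-triangle = count-triangle R? (λ i → totalPreorder-cotrans (total i))
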